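{- Every sequent $\vdash A_1,\dots,A_n$ that is derivable from the axioms and rules listed in the context is valid in every Q-structure under every assignment of facts to the propositional letters.
   Context: A Q-structure is a tuple $\langle \mathcal P,\mathcal Z,\cdot,1\rangle$ where $\mathcal P$ is a set, $\mathcal Z\subseteq\mathcal P$, $\cdot$ is a binary operation on $\mathcal P$ (not assumed associative or commutative), and $1\in\mathcal P$. These satisfy, for all $x,y,z\in\mathcal P$: (a) $x\cdot y\in\mathcal Z$ iff $y\cdot x\in\mathcal Z$; (b) $(x\cdot y)\cdot z\in\mathcal Z$ iff $x\cdot(z\cdot y)\in\mathcal Z$; and $1\cdot x=x\cdot 1=x$. For $A\subseteq\mathcal P$ let $A^\perp=\{b\in\mathcal P: b\cdot a\in\mathcal Z \text{ for all } a\in A\}$. A fact is a set $F$ with $F=(F^\perp)^\perp$. For $A,B\subseteq\mathcal P$ let $A\cdot B=\{a\cdot b: a\in A,b\in B\}$. Operations on facts: - $\sim F=F^\perp$; - $F\otimes G=((F\cdot G)^\perp)^\perp$; - $F\wp G=(F^\perp\cdot G^\perp)^\perp$ ("par"); - $F\& G=F\cap G$; - $F\oplus G=((F\cup G)^\perp)^\perp$. Formulas are built from propositional letters $a$ and their negations $\sim a$, the constants $\mathbf 1,\top$ and their negations $\sim\mathbf 1,\sim\top$, using the binary connectives $\otimes,\wp,\&,\oplus$. Negation of a compound formula is defined by De Morgan duality: $\sim(A\otimes B)=\sim A\wp\sim B$, $\sim(A\wp B)=\sim A\otimes\sim B$, $\sim(A\& B)=\sim A\oplus\sim B$, $\sim(A\oplus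 B)=\sim A\&\sim B$, and $\sim\sim A=A$. An assignment gives each letter a fact. Formulas are then interpreted as facts: $\mathbf 1$ as $\mathcal Z^\perp$, $\top$ as $\mathcal P$, $\sim$ as $^\perp$, and each connective by the corresponding operation above. A sequent $\vdash A_1,\dots,A_n$ ($n\ge1$) is valid in the structure under the assignment iff the element $1$ belongs to the interpretation of $(\cdots(A_1\wp A_2)\wp\cdots)\wp A_n$, associated to the left. Axioms and rules, where $A,B,C,D$ are formulas and $\sigma$ is a finite sequence of formulas: - Logical axiom: $\vdash\sim A,A$. - Cut: from $\vdash A,B$ and $\vdash\sim A,C$ infer $\vdash B,C$. - Exchange1: from $\vdash A_1,A_2$ infer $\vdash A_2,A_1$. - Exchange2: from $\vdash A_1,A_2,A_3$ infer $\vdash A_3,A_2,A_1$. - Axiom $\top$: $\vdash\top,A$. - $\&$: from $\vdash A,C$ and $\vdash B,C$ infer $\vdash A\& B,C$. - $\oplus1$: from $\vdash A,C$ infer $\vdash A\oplus B,C$. - $\oplus2$: from $\vdash A,C$ infer $\vdash B\oplus A,C$. - Axiom1: $\vdash\mathbf 1$. - $\bot$: from $\vdash A$ infer $\vdash\sim\mathbf 1,A$. - $\otimes$: from $\vdash A,C$ and $\vdash B,D$ infer $\vdash C,D,A\otimes B$. - $\wp$: from $\vdash A,B,\sigma$ infer $\vdash A\wp B,\sigma$. -}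

module Defs where

open import Data.Nat using (ℕ)
open import Data.Product using (Σ; ∃; _×_; _,_)
open import Data.Sum using (_⊎_)
open import Data.Unit using (⊤)
open import Data.List using (List; []; _∷_)
open import Data.List.NonEmpty using (List⁺; _∷_)
open import Relation.Binary.PropositionalEquality using (_≡_)
open import Function.Bundles using (_⇔_)

record QStructure : Set₁ where
  field
    P      : Set
    Z      : P → Set
    _·_    : P → P → P
    one    : P
    comm-Z  : ∀ x y → Z (x · y) ⇔ Z (y · x)
    assoc-Z : ∀ x y z → Z ((x · y) · z) ⇔ Z (x · (z · y))
    unitˡ   : ∀ x → one · x ≡ x
    unitʳ   : ∀ x → x · one ≡ x

Subset : Set → Set₁
Subset X = X → Set

module _ (Q : QStructure) where
  open QStructure Q

  _⊥ : Subset P → Subset P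
  (A ⊥) b = ∀ a → A a → Z (b · a)

  _⋆_ : Subset P → Subset P → Subset P
  (A ⋆ B) c = Σ P λ a → Σ P λ b → A a × B b × (c ≡ a · b)

  _∪_ : Subset P → Subset P → Subset P
  (A ∪ B) c = A c ⊎ B c

  _∩_ : Subset P → Subset P → Subset P
  (A ∩ B) c = A c × B c

  IsFact : Subset P → Set
  IsFact F = ∀ x → F x ⇔ ((F ⊥) ⊥) x

  Fact : Set₁
  Fact = Σ (Subset P) IsFact

  ~ᶠ_ : Subset P → Subset P
  ~ᶠ F = F ⊥

  _⊗ᶠ_ : Subset P → Subset P → Subset P
  F ⊗ᶠ G = ((F ⋆ G) ⊥) ⊥

  _℘ᶠ_ : Subset P → Subset P → Subset P
  F ℘ᶠ G = ((F ⊥) ⋆ (G ⊥)) ⊥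

  _&ᶠ_ : Subset P → Subset P → Subset P
  F &ᶠ G = F ∩ G

  _⊕ᶠ_ : Subset P → Subset P → Subset P
  F ⊕ᶠ G = ((F ∪ G) ⊥) ⊥

Letter : Set
Letter = ℕ

infixr 6 _⊗_ _℘_ _&_ _⊕_

data Formula : Set where
  var  : Letter → Formula
  nvar : Letter → Formula
  𝟏    : Formula
  ~𝟏   : Formula
  ⊤'   : Formula
  ~⊤   : Formula
  _⊗_ _℘_ _&_ _⊕_ : Formula → Formula → Formula

∼_ : Formula → Formula
∼ var a   = nvar a
∼ nvar a  = var a
∼ 𝟏       = ~𝟏
∼ ~𝟏      = 𝟏
∼ ⊤'      = ~⊤
∼ ~⊤      = ⊤'
∼ (A ⊗ B) = (∼ A) ℘ (∼ B)
∼ (A ℘ B) = (∼ A) ⊗ (∼ B)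
∼ (A & B) = (∼ A) ⊕ (∼ B)
∼ (A ⊕ B) = (∼ A) & (∼ B)

Assignment : QStructure → Set₁
Assignment Q = Letter → Fact Q

module _ (Q : QStructure) (ρ : Assignment Q) where
  open QStructure Q

  ⟦_⟧ : Formula → Subset P
  ⟦ var a ⟧  = Data.Product.proj₁ (ρ a)
  ⟦ nvar a ⟧ = ~ᶠ_ Q (Data.Product.proj₁ (ρ a))
  ⟦ 𝟏 ⟧      = _⊥ Q Z
  ⟦ ~𝟏 ⟧     = _⊥ Q (_⊥ Q Z)
  ⟦ ⊤' ⟧     = λ _ → ⊤
  ⟦ ~⊤ ⟧     = _⊥ Q (λ _ → ⊤)
  ⟦ A ⊗ B ⟧  = _⊗ᶠ_ Q ⟦ A ⟧ ⟦ B ⟧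
  ⟦ A ℘ B ⟧  = _℘ᶠ_ Q ⟦ A ⟧ ⟦ B ⟧
  ⟦ A & B ⟧  = _&ᶠ_ Q ⟦ A ⟧ ⟦ B ⟧
  ⟦ A ⊕ B ⟧  = _⊕ᶠ_ Q ⟦ A ⟧ ⟦ B ⟧

parLeft : Formula → List Formula → Formula
parLeft A []      = A
parLeft A (B ∷ σ) = parLeft (A ℘ B) σ

Sequent : Set
Sequent = List⁺ Formula

Valid : (Q : QStructure) → Assignment Q → Sequent → Set
Valid Q ρ (A ∷ σ) = ⟦_⟧ Q ρ (parLeft A σ) (QStructure.one Q)

data ⊢_ : Sequent → Set where
  ax     : ∀ A → ⊢ (∼ A ∷ A ∷ [])
  cut    : ∀ {A B C} → ⊢ (A ∷ B ∷ []) → ⊢ (∼ A ∷ C ∷ []) → ⊢ (B ∷ C ∷ [])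
  exch1  : ∀ {A₁ A₂} → ⊢ (A₁ ∷ A₂ ∷ []) → ⊢ (A₂ ∷ A₁ ∷ [])
  exch2  : ∀ {A₁ A₂ A₃} → ⊢ (A₁ ∷ A₂ ∷ A₃ ∷ []) → ⊢ (A₃ ∷ A₂ ∷ A₁ ∷ [])
  ax⊤    : ∀ A → ⊢ (⊤' ∷ A ∷ [])
  r&     : ∀ {A B C} → ⊢ (A ∷ C ∷ []) → ⊢ (B ∷ C ∷ []) → ⊢ (A & B ∷ C ∷ [])
  r⊕1    : ∀ {A B C} → ⊢ (A ∷ C ∷ []) → ⊢ (A ⊕ B ∷ C ∷ [])
  r⊕2    : ∀ {A B C} → ⊢ (A ∷ C ∷ []) → ⊢ (B ⊕ A ∷ C ∷ [])
  ax1    : ⊢ (𝟏 ∷ [])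
  r⊥     : ∀ {A} → ⊢ (A ∷ []) → ⊢ (~𝟏 ∷ A ∷ [])
  r⊗     : ∀ {A B C D} → ⊢ (A ∷ C ∷ []) → ⊢ (B ∷ D ∷ []) → ⊢ (C ∷ D ∷ A ⊗ B ∷ [])
  r℘     : ∀ {A B σ} → ⊢ (A ∷ B ∷ σ) → ⊢ (A ℘ B ∷ σ)

module Submission where

-- Every interpreted formula is a fact and ⟦ ∼ A ⟧ = ⟦ A ⟧ᗮ, so, using 1 · x = x and the
-- symmetry of 𝒵, a sequent ⊢ A , B is valid exactly when ⟦ A ⟧ᗮ ⊆ ⟦ B ⟧; longer sequents
-- reduce to this because ⊢ A , B , σ is valid iff ⊢ A ℘ B , σ is.  Each rule then becomes
-- an inclusion between orthogonals, proved by the antitonicity of ᗮ and closedness of facts.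
-- Axiom (b) is needed only for Exchange2, where it rotates (a · b) · c ∈ 𝒵 to (c · b) · a ∈ 𝒵.

open import Defs hiding (_∪_; _∩_)
open import Data.Product using (_,_; proj₁; proj₂)
open import Data.Sum using (inj₁; inj₂)
open import Data.Unit using (tt)
open import Data.List using ([]; _∷_)
open import Data.List.NonEmpty using (_∷_)
open import Relation.Binary.PropositionalEquality using (refl; subst; sym)
open import Relation.Unary using (_⊆′_; _≐′_; _∪_; _∩_)
open import Relation.Unary.Properties using (⊆′-trans; ≐′-refl; ≐′-sym; ≐′-trans)
open import Function.Bundles using (_⇔_; mk⇔; Equivalence)

module Orthogonality (Q : QStructure) where
  open QStructure Q

  infix 10 _ᗮ
  infixl 8 _⊙_

  private variable X X′ Y Y′ W : Subset P

  _ᗮ : Subset P → Subset P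
  X ᗮ = _⊥ Q X

  _⊙_ : Subset P → Subset P → Subset P
  X ⊙ Y = _⋆_ Q X Y

  Z-comm : ∀ {x y} → Z (x · y) → Z (y · x)
  Z-comm {x} {y} = Equivalence.to (comm-Z x y)

  ⊆ᗮᗮ : (X : Subset P) → X ⊆′ X ᗮ ᗮ
  ⊆ᗮᗮ X x Xx b Xᗮb = Z-comm (Xᗮb x Xx)

  ᗮ-antitone : X ⊆′ Y → Y ᗮ ⊆′ X ᗮ
  ᗮ-antitone X⊆Y b Yᗮb a Xa = Yᗮb a (X⊆Y a Xa)

  ᗮᗮ-mono : X ⊆′ Y → X ᗮ ᗮ ⊆′ Y ᗮ ᗮ
  ᗮᗮ-mono X⊆Y = ᗮ-antitone (ᗮ-antitone X⊆Y)

  ᗮᗮᗮ⊆ᗮ : (X : Subset P) → X ᗮ ᗮ ᗮ ⊆′ X ᗮ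
  ᗮᗮᗮ⊆ᗮ X = ᗮ-antitone (⊆ᗮᗮ X)

  ᗮᗮᗮ≐ᗮ : (X : Subset P) → X ᗮ ᗮ ᗮ ≐′ X ᗮ
  ᗮᗮᗮ≐ᗮ X = ᗮᗮᗮ⊆ᗮ X , ⊆ᗮᗮ (X ᗮ)

  ᗮᗮ-⊆ᗮ : X ⊆′ Y ᗮ → X ᗮ ᗮ ⊆′ Y ᗮ
  ᗮᗮ-⊆ᗮ {Y = Y} X⊆Yᗮ = ⊆′-trans (ᗮᗮ-mono X⊆Yᗮ) (ᗮᗮᗮ⊆ᗮ Y)

  ᗮ-cong : X ≐′ Y → X ᗮ ≐′ Y ᗮ
  ᗮ-cong (X⊆Y , Y⊆X) = ᗮ-antitone Y⊆X , ᗮ-antitone X⊆Y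

  ᗮ-∪ : (X Y : Subset P) → (X ∪ Y) ᗮ ≐′ X ᗮ ∩ Y ᗮ
  ᗮ-∪ X Y = (λ b h → (λ a Xa → h a (inj₁ Xa)) , (λ a Ya → h a (inj₂ Ya)))
          , λ { b (Xᗮb , Yᗮb) a (inj₁ Xa) → Xᗮb a Xa
              ; b (Xᗮb , Yᗮb) a (inj₂ Ya) → Yᗮb a Ya }

  ∩-cong : X ≐′ X′ → Y ≐′ Y′ → X ∩ Y ≐′ X′ ∩ Y′
  ∩-cong (X⊆X′ , X′⊆X) (Y⊆Y′ , Y′⊆Y) =
      (λ c (Xc , Yc) → X⊆X′ c Xc , Y⊆Y′ c Yc)
    , (λ c (X′c , Y′c) → X′⊆X c X′c , Y′⊆Y c Y′c)

  ⊙-mono : X ⊆′ X′ → Y ⊆′ Y′ → X ⊙ Y ⊆′ X′ ⊙ Y′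
  ⊙-mono X⊆X′ Y⊆Y′ c (x , y , Xx , Yy , c≡xy) = x , y , X⊆X′ x Xx , Y⊆Y′ y Yy , c≡xy

  ⊙-cong : X ≐′ X′ → Y ≐′ Y′ → X ⊙ Y ≐′ X′ ⊙ Y′
  ⊙-cong (X⊆X′ , X′⊆X) (Y⊆Y′ , Y′⊆Y) = ⊙-mono X⊆X′ Y⊆Y′ , ⊙-mono X′⊆X Y′⊆Y

  ⊙-rotate : X ⊙ Y ⊆′ W ᗮ → W ⊙ Y ⊆′ X ᗮ
  ⊙-rotate XY⊆Wᗮ _ (w , y , Ww , Yy , refl) x Xx =
    Z-comm (Equivalence.to (assoc-Z x y w) (XY⊆Wᗮ (x · y) (x , y , Xx , Yy , refl) w Ww))

  one∈⊙ᗮ⇔⊆ᗮ : ((X ⊙ Y) ᗮ) one ⇔ X ⊆′ Y ᗮ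
  one∈⊙ᗮ⇔⊆ᗮ = mk⇔
    (λ h x Xx y Yy → subst Z (unitˡ (x · y)) (h (x · y) (x , y , Xx , Yy , refl)))
    (λ { X⊆Yᗮ _ (x , y , Xx , Yy , refl) → subst Z (sym (unitˡ (x · y))) (X⊆Yᗮ x Xx y Yy) })

  one∈⇒ᗮ⊆Z : X one → X ᗮ ⊆′ Z
  one∈⇒ᗮ⊆Z Xone b Xᗮb = subst Z (unitʳ b) (Xᗮb one Xone)

module Soundness (Q : QStructure) (ρ : Assignment Q) where
  open QStructure Q
  open Orthogonality Q

  ⟪_⟫ : Formula → Subset P
  ⟪ A ⟫ = ⟦_⟧ Q ρ A

  ⟪⟫-closed : ∀ A → ⟪ A ⟫ ᗮ ᗮ ⊆′ ⟪ A ⟫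
  ⟪⟫-closed (var a)  x = Equivalence.from (proj₂ (ρ a) x)
  ⟪⟫-closed (nvar a) = ᗮᗮᗮ⊆ᗮ ⟪ var a ⟫
  ⟪⟫-closed 𝟏        = ᗮᗮᗮ⊆ᗮ Z
  ⟪⟫-closed ~𝟏       = ᗮᗮᗮ⊆ᗮ (Z ᗮ)
  ⟪⟫-closed ⊤'       _ _ = tt
  ⟪⟫-closed ~⊤       = ᗮᗮᗮ⊆ᗮ ⟪ ⊤' ⟫
  ⟪⟫-closed (A ⊗ B)  = ᗮᗮᗮ⊆ᗮ ((⟪ A ⟫ ⊙ ⟪ B ⟫) ᗮ)
  ⟪⟫-closed (A ℘ B)  = ᗮᗮᗮ⊆ᗮ (⟪ A ⟫ ᗮ ⊙ ⟪ B ⟫ ᗮ)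
  ⟪⟫-closed (A & B)  x h = ⟪⟫-closed A x (ᗮᗮ-mono (λ _ → proj₁) x h)
                         , ⟪⟫-closed B x (ᗮᗮ-mono (λ _ → proj₂) x h)
  ⟪⟫-closed (A ⊕ B)  = ᗮᗮᗮ⊆ᗮ ((⟪ A ⟫ ∪ ⟪ B ⟫) ᗮ)

  ⟪⟫≐ᗮᗮ : ∀ A → ⟪ A ⟫ ≐′ ⟪ A ⟫ ᗮ ᗮ
  ⟪⟫≐ᗮᗮ A = ⊆ᗮᗮ ⟪ A ⟫ , ⟪⟫-closed A

  ⟪∼⟫≐ᗮ : ∀ A → ⟪ ∼ A ⟫ ≐′ ⟪ A ⟫ ᗮ
  ⟪∼⟫ᗮ≐ : ∀ A → ⟪ ∼ A ⟫ ᗮ ≐′ ⟪ A ⟫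
  ⟪∼⟫ᗮ≐ A = ≐′-trans (ᗮ-cong (⟪∼⟫≐ᗮ A)) (≐′-sym (⟪⟫≐ᗮᗮ A))

  ⟪∼⟫≐ᗮ (var a)  = ≐′-refl
  ⟪∼⟫≐ᗮ (nvar a) = ⟪⟫≐ᗮᗮ (var a)
  ⟪∼⟫≐ᗮ 𝟏        = ≐′-refl
  ⟪∼⟫≐ᗮ ~𝟏       = ≐′-sym (ᗮᗮᗮ≐ᗮ Z)
  ⟪∼⟫≐ᗮ ⊤'       = ≐′-refl
  ⟪∼⟫≐ᗮ ~⊤       = ⟪⟫≐ᗮᗮ ⊤'
  ⟪∼⟫≐ᗮ (A ⊗ B)  = ≐′-trans (ᗮ-cong (⊙-cong (⟪∼⟫ᗮ≐ A) (⟪∼⟫ᗮ≐ B)))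
                            (≐′-sym (ᗮᗮᗮ≐ᗮ (⟪ A ⟫ ⊙ ⟪ B ⟫)))
  ⟪∼⟫≐ᗮ (A ℘ B)  = ᗮ-cong (ᗮ-cong (⊙-cong (⟪∼⟫≐ᗮ A) (⟪∼⟫≐ᗮ B)))
  ⟪∼⟫≐ᗮ (A & B)  = ≐′-trans (ᗮ-cong (ᗮ-∪ ⟪ ∼ A ⟫ ⟪ ∼ B ⟫))
                            (ᗮ-cong (∩-cong (⟪∼⟫ᗮ≐ A) (⟪∼⟫ᗮ≐ B)))
  ⟪∼⟫≐ᗮ (A ⊕ B)  = ≐′-sym (≐′-trans (ᗮᗮᗮ≐ᗮ (⟪ A ⟫ ∪ ⟪ B ⟫))
                                   (≐′-trans (ᗮ-∪ ⟪ A ⟫ ⟪ B ⟫)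
                                             (∩-cong (≐′-sym (⟪∼⟫≐ᗮ A)) (≐′-sym (⟪∼⟫≐ᗮ B)))))

  valid₂⇔ : ∀ A B → Valid Q ρ (A ∷ B ∷ []) ⇔ ⟪ A ⟫ ᗮ ⊆′ ⟪ B ⟫
  valid₂⇔ A B = mk⇔
    (λ h → ⊆′-trans (to h) (⟪⟫-closed B))
    (λ Aᗮ⊆B → from (⊆′-trans Aᗮ⊆B (⊆ᗮᗮ ⟪ B ⟫)))
    where open Equivalence (one∈⊙ᗮ⇔⊆ᗮ {⟪ A ⟫ ᗮ} {⟪ B ⟫ ᗮ})

  ᗮ⊆-swap : ∀ A B → ⟪ A ⟫ ᗮ ⊆′ ⟪ B ⟫ → ⟪ B ⟫ ᗮ ⊆′ ⟪ A ⟫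
  ᗮ⊆-swap A B Aᗮ⊆B = ⊆′-trans (ᗮ-antitone Aᗮ⊆B) (⟪⟫-closed A)

  ℘-exchange : ∀ A₁ A₂ A₃ → ⟪ A₁ ℘ A₂ ⟫ ᗮ ⊆′ ⟪ A₃ ⟫ → ⟪ A₃ ℘ A₂ ⟫ ᗮ ⊆′ ⟪ A₁ ⟫
  ℘-exchange A₁ A₂ A₃ h =
    ⊆′-trans (ᗮᗮ-⊆ᗮ (⊙-rotate (⊆′-trans (⊆ᗮᗮ (⟪ A₁ ⟫ ᗮ ⊙ ⟪ A₂ ⟫ ᗮ))
                                        (⊆′-trans h (⊆ᗮᗮ ⟪ A₃ ⟫)))))
             (⟪⟫-closed A₁)

  valid₂ : ∀ A B → ⟪ A ⟫ ᗮ ⊆′ ⟪ B ⟫ → Valid Q ρ (A ∷ B ∷ [])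
  valid₂ A B = Equivalence.from (valid₂⇔ A B)

  valid₂⁻¹ : ∀ A B → Valid Q ρ (A ∷ B ∷ []) → ⟪ A ⟫ ᗮ ⊆′ ⟪ B ⟫
  valid₂⁻¹ A B = Equivalence.to (valid₂⇔ A B)

  ⊢-sound : ∀ {s} → ⊢ s → Valid Q ρ s
  ⊢₂-sound : ∀ {A B} → ⊢ (A ∷ B ∷ []) → ⟪ A ⟫ ᗮ ⊆′ ⟪ B ⟫
  ⊢₂-sound {A} {B} d = valid₂⁻¹ A B (⊢-sound d)

  ⊢-sound (ax A) = valid₂ (∼ A) A (proj₁ (⟪∼⟫ᗮ≐ A))
  ⊢-sound (cut {A} {B} {C} d₁ d₂) =
    valid₂ B C (⊆′-trans (ᗮ⊆-swap A B (⊢₂-sound d₁))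
                         (⊆′-trans (proj₂ (⟪∼⟫ᗮ≐ A)) (⊢₂-sound d₂)))
  ⊢-sound (exch1 {A₁} {A₂} d) = valid₂ A₂ A₁ (ᗮ⊆-swap A₁ A₂ (⊢₂-sound d))
  ⊢-sound (exch2 {A₁} {A₂} {A₃} d) =
    valid₂ (A₃ ℘ A₂) A₁ (℘-exchange A₁ A₂ A₃ (valid₂⁻¹ (A₁ ℘ A₂) A₃ (⊢-sound d)))
  ⊢-sound (ax⊤ A) = valid₂ ⊤' A (ᗮ⊆-swap A ⊤' (λ _ _ → tt))
  ⊢-sound (r& {A} {B} {C} d₁ d₂) = valid₂ (A & B) C (ᗮ⊆-swap C (A & B) Cᗮ⊆A&B)
    where
      Cᗮ⊆A&B : ⟪ C ⟫ ᗮ ⊆′ ⟪ A & B ⟫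
      Cᗮ⊆A&B x h = ᗮ⊆-swap A C (⊢₂-sound d₁) x h , ᗮ⊆-swap B C (⊢₂-sound d₂) x h
  ⊢-sound (r⊕1 {A} {B} {C} d) = valid₂ (A ⊕ B) C (ᗮ⊆-swap C (A ⊕ B) Cᗮ⊆A⊕B)
    where
      Cᗮ⊆A⊕B : ⟪ C ⟫ ᗮ ⊆′ ⟪ A ⊕ B ⟫
      Cᗮ⊆A⊕B x h = ⊆ᗮᗮ (⟪ A ⟫ ∪ ⟪ B ⟫) x (inj₁ (ᗮ⊆-swap A C (⊢₂-sound d) x h))
  ⊢-sound (r⊕2 {A} {B} {C} d) = valid₂ (B ⊕ A) C (ᗮ⊆-swap C (B ⊕ A) Cᗮ⊆B⊕A)
    where
      Cᗮ⊆B⊕A : ⟪ C ⟫ ᗮ ⊆′ ⟪ B ⊕ A ⟫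
      Cᗮ⊆B⊕A x h = ⊆ᗮᗮ (⟪ B ⟫ ∪ ⟪ A ⟫) x (inj₂ (ᗮ⊆-swap A C (⊢₂-sound d) x h))
  ⊢-sound ax1 a Za = subst Z (sym (unitˡ a)) Za
  ⊢-sound (r⊥ {A} d) =
    valid₂ ~𝟏 A (ᗮ⊆-swap A ~𝟏 (⊆′-trans (one∈⇒ᗮ⊆Z (⊢-sound d)) (⊆ᗮᗮ Z)))
  ⊢-sound (r⊗ {A} {B} {C} {D} d₁ d₂) =
    valid₂ (C ℘ D) (A ⊗ B)
      (ᗮᗮ-mono (⊙-mono (ᗮ⊆-swap A C (⊢₂-sound d₁)) (ᗮ⊆-swap B D (⊢₂-sound d₂))))
  -- Valid (A ∷ B ∷ σ) and Valid (A ℘ B ∷ σ) are the same type.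
  ⊢-sound (r℘ d) = ⊢-sound d

theorem1 : (Q : QStructure) (ρ : Assignment Q) (s : Sequent) → ⊢ s → Valid Q ρ s
theorem1 Q ρ s = Soundness.⊢-sound Q ρ
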